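{- Let $n \geq 2203$ be an integer. Consider the following system $T$ of equations in the variables $x_1,\ldots,x_{n+11}$: \[ \begin{array}{rcl} x_i \cdot x_i & = & x_{i+1} \quad \text{for every } i \in \{1,\ldots,n\},\\ x_{n+2} + x_{n+2} & = & x_{n+3},\\ x_{n+3} + x_{n+3} & = & x_{n+4},\\ x_{n+4} + x_{n+2} & = & x_{n+5},\\ x_{n+6} & = & 1,\\ x_{n+5}+x_{n+6} & = & x_{n+7},\\ x_{n+7}+x_{n+6} & = & x_{n+8},\\ x_{n+8}+x_{n+6} & = & x_1,\\ x_{n+8} \cdot x_{n+8} & = & x_{n+9},\\ x_{n+9} \cdot x_{n+10} & = & x_{n+11},\\ x_{n+11}+x_1 & = & x_{2204}. \end{array} \] Then $T$ has a unique integer solution $(a_1,\ldots,a_{n+11}) \in \mathbb{Z}^{n+11}$. Moreover, the numbers $a_1,\ldots,a_{n+11}$ are positive and $\max(a_1,\ldots,a_{n+11}) > 2^{2^{n+11}}$.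
   Context: Since $n \geq 2203$, the index $2204$ lies in $\{1,\ldots,n+1\}$, so $x_{2204}$ is one of the variables $x_1,\ldots,x_{n+11}$. -}

module Defs where

open import Data.Nat using (ℕ; _≤_)
open import Data.Integer using (ℤ; _+_; _*_; +_)
open import Relation.Binary.PropositionalEquality using (_≡_)
open import Data.Product using (_×_)

-- An assignment of integers to the variables x_1, …, x_{n+11} is represented
-- as a function x : ℕ → ℤ of which only the indices 1 … n+11 are relevant
-- (the system and all conclusions only inspect those indices).

InRange : ℕ → ℕ → Set
InRange n i = (1 ≤ i) × (i ≤ n Data.Nat.+ 11)

record Solves (n : ℕ) (x : ℕ → ℤ) : Set where
  open Data.Nat using () renaming (_+_ to _⊕_)
  field
    sq   : ∀ i → 1 ≤ i → i ≤ n → x i * x i ≡ x (i ⊕ 1)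
    e2   : x (n ⊕ 2) + x (n ⊕ 2) ≡ x (n ⊕ 3)
    e3   : x (n ⊕ 3) + x (n ⊕ 3) ≡ x (n ⊕ 4)
    e4   : x (n ⊕ 4) + x (n ⊕ 2) ≡ x (n ⊕ 5)
    e6   : x (n ⊕ 6) ≡ + 1
    e7   : x (n ⊕ 5) + x (n ⊕ 6) ≡ x (n ⊕ 7)
    e8   : x (n ⊕ 7) + x (n ⊕ 6) ≡ x (n ⊕ 8)
    e1   : x (n ⊕ 8) + x (n ⊕ 6) ≡ x 1
    e9   : x (n ⊕ 8) * x (n ⊕ 8) ≡ x (n ⊕ 9)
    e11  : x (n ⊕ 9) * x (n ⊕ 10) ≡ x (n ⊕ 11)
    e2204 : x (n ⊕ 11) + x 1 ≡ x 2204

-- Write d = x_{n+8}. The linear equations give d = 5 x_{n+2} + 2 and x_1 = d + 1, the squaring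
-- chain gives x_{2204} = x_1^N with N = 2^2203, and the last three equations turn into
-- d² x_{n+10} + d + 1 = (1 + d)^N. Expanding (1 + d)^N modulo d² shows that d divides N − 1,
-- which is the Mersenne prime 2^2203 − 1; since d ≡ 2 (mod 5), the only admissible divisor is
-- d = N − 1 itself, and then every variable is determined. Conversely these values solve T,
-- and x_{n+1} = 2^(2203·2^n) exceeds 2^(2^(n+11)).
--
-- Primality of 2^2203 − 1 is certified by the Lucas–Lehmer test, run by the type checker. If
-- Re((2 + √3)^(2^p)) vanishes modulo M = 2^(p+2) − 1, then modulo any divisor q ≥ 3 of M the
-- unit 2 + √3 has no period below 2^(p+2), while the pigeonhole principle over the q² residue
-- pairs produces one as soon as q² < 2^(p+2); hence q² > M for every such q.

module Submission where

open import Defs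
open import Data.Nat using (ℕ; zero; suc)
open import Data.Product using (_×_; _,_; proj₁; proj₂)
open import Relation.Binary.PropositionalEquality

module Congruence where
  open import Level using (0ℓ)
  open import Data.Nat as ℕ using (NonZero; _<_)
  open import Data.Nat.Properties using (<⇒≱)
  open import Data.Nat.DivMod using (_%_; _/_; m≡m%n+[m/n]*n)
  open import Data.Nat.Divisibility using (∣⇒≤) renaming (_∣_ to _∣ᴺ_)
  open import Data.Integer using (ℤ; +_; -_; _+_; _-_; _*_; ∣_∣)
  open import Data.Integer.Properties using (+-inverseʳ; pos-+; pos-*)
  open import Data.Integer.DivMod using (_%ℕ_; _/ℕ_; n%ℕd<d; a≡a%ℕn+[a/ℕn]*n)
  open import Data.Integer.Divisibility.Signed
    using (_∣_; divides; ∣m∣n⇒∣m+n; ∣m⇒∣-m; ∣m⇒∣m*n; ∣n⇒∣m*n; ∣-trans; ∣ᵤ⇒∣; ∣⇒∣ᵤ)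
  open import Data.Integer.Tactic.RingSolver using (solve-∀)
  open import Data.Fin using (Fin; toℕ; fromℕ<)
  open import Data.Fin.Properties using (toℕ-fromℕ<)
  open import Relation.Binary.Bundles using (Setoid)
  import Relation.Binary.Reasoning.Setoid as SetoidReasoning
  open import Relation.Nullary using (¬_)

  infix 4 _≡_mod_
  record _≡_mod_ (x y : ℤ) (q : ℕ) : Set where
    constructor congruent
    field
      divides-difference : + q ∣ x - y

  ≡-mod-reflexive : ∀ {q x y} → x ≡ y → x ≡ y mod q
  ≡-mod-reflexive {x = x} refl = congruent (divides (+ 0) (+-inverseʳ x))

  ≡-mod-refl : ∀ {q} x → x ≡ x mod q
  ≡-mod-refl x = ≡-mod-reflexive {x = x} refl

  ≡-mod-sym : ∀ {q x y} → x ≡ y mod q → y ≡ x mod q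
  ≡-mod-sym {x = x} {y} (congruent q∣x-y) = congruent (subst (_ ∣_) (identity x y) (∣m⇒∣-m q∣x-y))
    where identity : ∀ x y → - (x - y) ≡ y - x
          identity = solve-∀

  ≡-mod-trans : ∀ {q x y z} → x ≡ y mod q → y ≡ z mod q → x ≡ z mod q
  ≡-mod-trans {x = x} {y} {z} (congruent q∣x-y) (congruent q∣y-z) =
    congruent (subst (_ ∣_) (identity x y z) (∣m∣n⇒∣m+n q∣x-y q∣y-z))
    where identity : ∀ x y z → (x - y) + (y - z) ≡ x - z
          identity = solve-∀

  ≡-mod-setoid : ℕ → Setoid 0ℓ 0ℓ
  ≡-mod-setoid q = record
    { Carrier       = ℤ
    ; _≈_           = λ x y → x ≡ y mod q
    ; isEquivalence = record { refl = ≡-mod-refl _ ; sym = ≡-mod-sym ; trans = ≡-mod-trans }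
    }

  module ≡-mod-Reasoning q = SetoidReasoning (≡-mod-setoid q)

  +-cong-mod : ∀ {q x x′ y y′} → x ≡ x′ mod q → y ≡ y′ mod q → x + y ≡ x′ + y′ mod q
  +-cong-mod {x = x} {x′} {y} {y′} (congruent q∣x-x′) (congruent q∣y-y′) =
    congruent (subst (_ ∣_) (identity x x′ y y′) (∣m∣n⇒∣m+n q∣x-x′ q∣y-y′))
    where identity : ∀ x x′ y y′ → (x - x′) + (y - y′) ≡ (x + y) - (x′ + y′)
          identity = solve-∀

  *-cong-mod : ∀ {q x x′ y y′} → x ≡ x′ mod q → y ≡ y′ mod q → x * y ≡ x′ * y′ mod q
  *-cong-mod {x = x} {x′} {y} {y′} (congruent q∣x-x′) (congruent q∣y-y′) =
    congruent (subst (_ ∣_) (identity x x′ y y′)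
      (∣m∣n⇒∣m+n (∣m⇒∣m*n y q∣x-x′) (∣n⇒∣m*n x′ q∣y-y′)))
    where identity : ∀ x x′ y y′ → (x - x′) * y + x′ * (y - y′) ≡ x * y - x′ * y′
          identity = solve-∀

  -‿cong-mod : ∀ {q x y} → x ≡ y mod q → - x ≡ - y mod q
  -‿cong-mod {x = x} {y} (congruent q∣x-y) = congruent (subst (_ ∣_) (identity x y) (∣m⇒∣-m q∣x-y))
    where identity : ∀ x y → - (x - y) ≡ - x - - y
          identity = solve-∀

  ≡-mod-∣ : ∀ {q r x y} → r ∣ᴺ q → x ≡ y mod q → x ≡ y mod r
  ≡-mod-∣ r∣q (congruent q∣x-y) = congruent (∣-trans (∣ᵤ⇒∣ r∣q) q∣x-y)

  ≢-mod : ∀ {q x y} → 0 < ∣ x - y ∣ → ∣ x - y ∣ < q → ¬ x ≡ y mod q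
  ≢-mod 0<∣x-y∣ ∣x-y∣<q (congruent q∣x-y) =
    <⇒≱ ∣x-y∣<q (∣⇒≤ ⦃ ℕ.>-nonZero 0<∣x-y∣ ⦄ (∣⇒∣ᵤ q∣x-y))

  %-≡-mod : ∀ n q .{{_ : NonZero q}} → + n ≡ + (n % q) mod q
  %-≡-mod n q = congruent (divides (+ (n / q)) (begin
    + n - + (n % q)                           ≡⟨ cong (_- + (n % q)) division ⟩
    (+ (n % q) + + (n / q) * + q) - + (n % q) ≡⟨ identity (+ (n % q)) (+ (n / q) * + q) ⟩
    + (n / q) * + q                           ∎))
    where
    open ≡-Reasoning
    division : + n ≡ + (n % q) + + (n / q) * + q
    division = begin
      + n                           ≡⟨ cong +_ (m≡m%n+[m/n]*n n q) ⟩
      + (n % q ℕ.+ n / q ℕ.* q)     ≡⟨ pos-+ (n % q) (n / q ℕ.* q) ⟩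
      + (n % q) + + (n / q ℕ.* q)   ≡⟨ cong (λ m → + (n % q) + m) (pos-* (n / q) q) ⟩
      + (n % q) + + (n / q) * + q   ∎
    identity : ∀ r s → (r + s) - r ≡ s
    identity = solve-∀

  remainder : ∀ q .{{_ : NonZero q}} → ℤ → Fin q
  remainder q z = fromℕ< (n%ℕd<d z q)

  remainder-injective : ∀ q .{{_ : NonZero q}} {z z′} → remainder q z ≡ remainder q z′ → z ≡ z′ mod q
  remainder-injective q {z} {z′} same = congruent (divides (a - a′) (begin
    z - z′
      ≡⟨ cong₂ _-_ (a≡a%ℕn+[a/ℕn]*n z q) (a≡a%ℕn+[a/ℕn]*n z′ q) ⟩
    (+ r + a * + q) - (+ r′ + a′ * + q)
      ≡⟨ cong (λ s → (+ s + a * + q) - (+ r′ + a′ * + q)) r≡r′ ⟩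
    (+ r′ + a * + q) - (+ r′ + a′ * + q)
      ≡⟨ identity (+ r′) a a′ (+ q) ⟩
    (a - a′) * + q
      ∎))
    where
    open ≡-Reasoning
    r = z %ℕ q
    r′ = z′ %ℕ q
    a = z /ℕ q
    a′ = z′ /ℕ q
    r≡r′ : r ≡ r′
    r≡r′ = trans (sym (toℕ-fromℕ< (n%ℕd<d z q)))
                 (trans (cong toℕ same) (toℕ-fromℕ< (n%ℕd<d z′ q)))
    identity : ∀ r a b q → (r + a * q) - (r + b * q) ≡ (a - b) * q
    identity = solve-∀

module QuadraticIntegers where
  open import Level using (0ℓ)
  open import Data.Nat as ℕ using (NonZero; _<_; z<s; _≤_)
  import Data.Nat.Properties as ℕP
  open import Data.Integer using (ℤ; +_; -_; _+_; _-_; _*_)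
  open import Data.Integer.Tactic.RingSolver using (solve-∀)
  open import Data.Fin using (Fin; toℕ; combine)
  open import Data.Fin.Properties using (pigeonhole; combine-injective; toℕ<n)
  open import Data.Sum using (_⊎_; inj₁; inj₂)
  open import Data.Product using (∃; ∃₂)
  open import Algebra.Bundles using (CommutativeMonoid)
  import Algebra.Properties.CommutativeMonoid.Mult as Mult
  open import Relation.Binary.Bundles using (Setoid)
  import Relation.Binary.Reasoning.Setoid as SetoidReasoning
  open import Relation.Nullary using (¬_)
  open Congruence

  infix 5 _+√3·_
  record ℤ[√3] : Set where
    constructor _+√3·_
    field
      re im : ℤ
  open ℤ[√3] public

  infixl 7 _·_
  _·_ : ℤ[√3] → ℤ[√3] → ℤ[√3]
  (a +√3· b) · (c +√3· d) = (a * c + + 3 * (b * d)) +√3· (a * d + b * c)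

  𝟙 -𝟙 ω ω̄ : ℤ[√3]
  𝟙  = + 1 +√3· + 0
  -𝟙 = - + 1 +√3· + 0
  ω  = + 2 +√3· + 1
  ω̄  = + 2 +√3· - + 1

  norm : ℤ[√3] → ℤ
  norm (a +√3· b) = a * a - + 3 * (b * b)

  ·-comm : ∀ x y → x · y ≡ y · x
  ·-comm (a +√3· b) (c +√3· d) = cong₂ _+√3·_ (re-comm a b c d) (im-comm a b c d)
    where
    re-comm : ∀ a b c d → a * c + + 3 * (b * d) ≡ c * a + + 3 * (d * b)
    re-comm = solve-∀
    im-comm : ∀ a b c d → a * d + b * c ≡ c * b + d * a
    im-comm = solve-∀

  ·-assoc : ∀ x y z → (x · y) · z ≡ x · (y · z)
  ·-assoc (a +√3· b) (c +√3· d) (e +√3· f) = cong₂ _+√3·_ (re-assoc a b c d e f) (im-assoc a b c d e f)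
    where
    re-assoc : ∀ a b c d e f →
      (a * c + + 3 * (b * d)) * e + + 3 * ((a * d + b * c) * f)
        ≡ a * (c * e + + 3 * (d * f)) + + 3 * (b * (c * f + d * e))
    re-assoc = solve-∀
    im-assoc : ∀ a b c d e f →
      (a * c + + 3 * (b * d)) * f + (a * d + b * c) * e
        ≡ a * (c * f + d * e) + b * (c * e + + 3 * (d * f))
    im-assoc = solve-∀

  ·-identityˡ : ∀ x → 𝟙 · x ≡ x
  ·-identityˡ (a +√3· b) = cong₂ _+√3·_ (re-identity a b) (im-identity a b)
    where
    re-identity : ∀ a b → + 1 * a + + 3 * (+ 0 * b) ≡ a
    re-identity = solve-∀
    im-identity : ∀ a b → + 1 * b + + 0 * a ≡ b
    im-identity = solve-∀

  ·-commutativeMonoid : CommutativeMonoid 0ℓ 0ℓ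
  ·-commutativeMonoid = record
    { Carrier             = ℤ[√3]
    ; _≈_                 = _≡_
    ; _∙_                 = _·_
    ; ε                   = 𝟙
    ; isCommutativeMonoid = record
      { isMonoid = record
        { isSemigroup = record
          { isMagma = record { isEquivalence = isEquivalence ; ∙-cong = cong₂ _·_ }
          ; assoc   = ·-assoc
          }
        ; identity    = ·-identityˡ , λ x → trans (·-comm x 𝟙) (·-identityˡ x)
        }
      ; comm     = ·-comm
      }
    }

  open Mult ·-commutativeMonoid using (×-homo-+; ×-assocˡ; ×-distrib-+)

  infixr 8 _^_
  _^_ : ℤ[√3] → ℕ → ℤ[√3]
  x ^ n = Mult._×_ ·-commutativeMonoid n x

  ^-+ : ∀ x m n → x ^ (m ℕ.+ n) ≡ x ^ m · x ^ n
  ^-+ = ×-homo-+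

  ^-* : ∀ x m n → x ^ (m ℕ.* n) ≡ (x ^ n) ^ m
  ^-* x m n = sym (×-assocˡ x m n)

  ^-*-comm : ∀ x m n → x ^ (m ℕ.* n) ≡ (x ^ m) ^ n
  ^-*-comm x m n = trans (cong (x ^_) (ℕP.*-comm m n)) (^-* x n m)

  ^-double : ∀ x k → x ^ (2 ℕ.^ suc k) ≡ x ^ (2 ℕ.^ k) · x ^ (2 ℕ.^ k)
  ^-double x k = trans (^-+ x (2 ℕ.^ k) (2 ℕ.^ k ℕ.+ 0))
                       (cong (λ n → x ^ (2 ℕ.^ k) · x ^ n) (ℕP.+-identityʳ (2 ℕ.^ k)))

  ·-^ : ∀ x y n → (x · y) ^ n ≡ x ^ n · y ^ n
  ·-^ = ×-distrib-+

  𝟙^ : ∀ n → 𝟙 ^ n ≡ 𝟙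
  𝟙^ zero    = refl
  𝟙^ (suc n) = trans (·-identityˡ (𝟙 ^ n)) (𝟙^ n)

  -𝟙^odd : ∀ u → -𝟙 ^ suc (2 ℕ.* u) ≡ -𝟙
  -𝟙^odd u = cong (-𝟙 ·_) (trans (^-*-comm -𝟙 2 u) (𝟙^ u))

  norm-· : ∀ x y → norm (x · y) ≡ norm x * norm y
  norm-· (a +√3· b) (c +√3· d) = identity a b c d
    where
    identity : ∀ a b c d →
      (a * c + + 3 * (b * d)) * (a * c + + 3 * (b * d)) - + 3 * ((a * d + b * c) * (a * d + b * c))
        ≡ (a * a - + 3 * (b * b)) * (c * c - + 3 * (d * d))
    identity = solve-∀

  norm-^ : ∀ x n → norm x ≡ + 1 → norm (x ^ n) ≡ + 1
  norm-^ x zero    _        = refl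
  norm-^ x (suc n) norm[x]≡1 = begin
    norm (x · x ^ n)        ≡⟨ norm-· x (x ^ n) ⟩
    norm x * norm (x ^ n)   ≡⟨ cong₂ _*_ norm[x]≡1 (norm-^ x n norm[x]≡1) ⟩
    + 1                     ∎
    where open ≡-Reasoning

  T₂ : ℤ → ℤ
  T₂ c = + 2 * c * c - + 1

  T₂-cong-mod : ∀ {q c c′} → c ≡ c′ mod q → T₂ c ≡ T₂ c′ mod q
  T₂-cong-mod c≡c′ =
    +-cong-mod (*-cong-mod (*-cong-mod (≡-mod-refl (+ 2)) c≡c′) c≡c′) (≡-mod-refl (- + 1))

  re-square : ∀ x → norm x ≡ + 1 → re (x · x) ≡ T₂ (re x)
  re-square (a +√3· b) norm≡1 = begin
    a * a + + 3 * (b * b)                   ≡⟨ identity a b ⟩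
    + 2 * a * a - (a * a - + 3 * (b * b))   ≡⟨ cong (λ m → + 2 * a * a - m) norm≡1 ⟩
    + 2 * a * a - + 1                       ∎
    where
    open ≡-Reasoning
    identity : ∀ a b → a * a + + 3 * (b * b) ≡ + 2 * a * a - (a * a - + 3 * (b * b))
    identity = solve-∀

  infix 4 _≈_mod_
  _≈_mod_ : ℤ[√3] → ℤ[√3] → ℕ → Set
  x ≈ y mod q = re x ≡ re y mod q × im x ≡ im y mod q

  ≈-mod-reflexive : ∀ {q x y} → x ≡ y → x ≈ y mod q
  ≈-mod-reflexive x≡y = ≡-mod-reflexive (cong re x≡y) , ≡-mod-reflexive (cong im x≡y)

  ≈-mod-sym : ∀ {q x y} → x ≈ y mod q → y ≈ x mod q
  ≈-mod-sym (re≡ , im≡) = ≡-mod-sym re≡ , ≡-mod-sym im≡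

  ≈-mod-trans : ∀ {q x y z} → x ≈ y mod q → y ≈ z mod q → x ≈ z mod q
  ≈-mod-trans (re≡ , im≡) (re≡′ , im≡′) = ≡-mod-trans re≡ re≡′ , ≡-mod-trans im≡ im≡′

  ≈-mod-setoid : ℕ → Setoid 0ℓ 0ℓ
  ≈-mod-setoid q = record
    { Carrier       = ℤ[√3]
    ; _≈_           = λ x y → x ≈ y mod q
    ; isEquivalence = record { refl = ≈-mod-reflexive refl ; sym = ≈-mod-sym ; trans = ≈-mod-trans }
    }

  module ≈-mod-Reasoning q = SetoidReasoning (≈-mod-setoid q)

  ·-cong-mod : ∀ {q x x′ y y′} → x ≈ x′ mod q → y ≈ y′ mod q → x · y ≈ x′ · y′ mod q
  ·-cong-mod (a , b) (c , d) =
    +-cong-mod (*-cong-mod a c) (*-cong-mod (≡-mod-refl (+ 3)) (*-cong-mod b d)) ,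
    +-cong-mod (*-cong-mod a d) (*-cong-mod b c)

  ^-cong-mod : ∀ {q x y} n → x ≈ y mod q → x ^ n ≈ y ^ n mod q
  ^-cong-mod zero    _   = ≈-mod-reflexive refl
  ^-cong-mod (suc n) x≈y = ·-cong-mod x≈y (^-cong-mod n x≈y)

  𝟙≉-𝟙 : ∀ {q} → 3 ≤ q → ¬ 𝟙 ≈ -𝟙 mod q
  𝟙≉-𝟙 3≤q (re≡ , _) = ≢-mod z<s 3≤q re≡

  square-of-root : ∀ {q} x → norm x ≡ + 1 → re x ≡ + 0 mod q → x · x ≈ -𝟙 mod q
  square-of-root {q} x norm≡1 re≡0 = re-part , im-part
    where
    open ≡-mod-Reasoning q
    re-part : re (x · x) ≡ - + 1 mod q
    re-part = begin
      re (x · x)    ≡⟨ re-square x norm≡1 ⟩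
      T₂ (re x)     ≈⟨ T₂-cong-mod re≡0 ⟩
      T₂ (+ 0)      ∎
    identity : ∀ b → + 0 * b + b * + 0 ≡ + 0
    identity = solve-∀
    im-part : im (x · x) ≡ + 0 mod q
    im-part = begin
      re x * im x + im x * re x  ≈⟨ +-cong-mod (*-cong-mod re≡0 (≡-mod-refl (im x)))
                                               (*-cong-mod (≡-mod-refl (im x)) re≡0) ⟩
      + 0 * im x + im x * + 0    ≡⟨ identity (im x) ⟩
      + 0                        ∎

  ^-inverse : ∀ x y i → y · x ≡ 𝟙 → y ^ i · x ^ i ≡ 𝟙
  ^-inverse x y i y·x≡𝟙 = trans (sym (·-^ y x i)) (trans (cong (_^ i) y·x≡𝟙) (𝟙^ i))

  ^-cancel : ∀ x y i t → y · x ≡ 𝟙 → y ^ i · x ^ (i ℕ.+ t) ≡ x ^ t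
  ^-cancel x y i t y·x≡𝟙 = begin
    y ^ i · x ^ (i ℕ.+ t)       ≡⟨ cong (y ^ i ·_) (^-+ x i t) ⟩
    y ^ i · (x ^ i · x ^ t)     ≡⟨ sym (·-assoc (y ^ i) (x ^ i) (x ^ t)) ⟩
    (y ^ i · x ^ i) · x ^ t     ≡⟨ cong (_· x ^ t) (^-inverse x y i y·x≡𝟙) ⟩
    𝟙 · x ^ t                   ≡⟨ ·-identityˡ (x ^ t) ⟩
    x ^ t                       ∎
    where open ≡-Reasoning

  period : ∀ {q} x y i t → y · x ≡ 𝟙 → x ^ i ≈ x ^ (i ℕ.+ t) mod q → x ^ t ≈ 𝟙 mod q
  period {q} x y i t y·x≡𝟙 x^i≈x^[i+t] = begin
    x ^ t                   ≡⟨ sym (^-cancel x y i t y·x≡𝟙) ⟩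
    y ^ i · x ^ (i ℕ.+ t)   ≈⟨ ·-cong-mod (≈-mod-reflexive {x = y ^ i} refl) (≈-mod-sym x^i≈x^[i+t]) ⟩
    y ^ i · x ^ i           ≡⟨ ^-inverse x y i y·x≡𝟙 ⟩
    𝟙                       ∎
    where open ≈-mod-Reasoning q

  powers-collide : ∀ x q .{{_ : NonZero q}} T → q ℕ.* q < T →
                   ∃₂ λ i j → i < j × j < T × x ^ i ≈ x ^ j mod q
  powers-collide x q T q²<T =
    let i , j , i<j , same-class = pigeonhole q²<T class
        re≡ , im≡ = combine-injective _ _ _ _ same-class
    in toℕ i , toℕ j , i<j , toℕ<n j , remainder-injective q re≡ , remainder-injective q im≡
    where
    class : Fin T → Fin (q ℕ.* q)
    class i = combine (remainder q (re (x ^ toℕ i))) (remainder q (im (x ^ toℕ i)))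

  even-or-odd : ∀ t → ∃ λ h → t ≡ 2 ℕ.* h ⊎ t ≡ suc (2 ℕ.* h)
  even-or-odd zero          = 0 , inj₁ refl
  even-or-odd (suc zero)    = 0 , inj₂ refl
  even-or-odd (suc (suc t)) with even-or-odd t
  ... | h , inj₁ refl = suc h , inj₁ (sym (ℕP.*-suc 2 h))
  ... | h , inj₂ refl = suc h , inj₂ (cong suc (sym (ℕP.*-suc 2 h)))

  -- An odd period t would give -𝟙 = (y^(2^k))^t = (y^t)^(2^k) = 𝟙; an even one halves to y².
  no-small-period : ∀ {q} k y t → ¬ 𝟙 ≈ -𝟙 mod q → y ^ (2 ℕ.^ k) ≈ -𝟙 mod q →
                    0 < t → t < 2 ℕ.^ suc k → ¬ y ^ t ≈ 𝟙 mod q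
  no-small-period {q} k y t ±𝟙-distinct y^2^k≈-𝟙 0<t t<2^[k+1] y^t≈𝟙 with even-or-odd t
  ... | u , inj₂ refl = ±𝟙-distinct (begin
    𝟙                      ≡⟨ sym (𝟙^ (2 ℕ.^ k)) ⟩
    𝟙 ^ (2 ℕ.^ k)          ≈⟨ ^-cong-mod (2 ℕ.^ k) (≈-mod-sym y^t≈𝟙) ⟩
    (y ^ t) ^ (2 ℕ.^ k)    ≡⟨ trans (sym (^-*-comm y t (2 ℕ.^ k))) (^-* y t (2 ℕ.^ k)) ⟩
    (y ^ (2 ℕ.^ k)) ^ t    ≈⟨ ^-cong-mod t y^2^k≈-𝟙 ⟩
    -𝟙 ^ t                 ≡⟨ -𝟙^odd u ⟩
    -𝟙                     ∎)
    where open ≈-mod-Reasoning q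
  ... | h , inj₁ refl with k | ℕP.*-cancelˡ-< 2 0 h 0<t | ℕP.*-cancelˡ-< 2 h (2 ℕ.^ k) t<2^[k+1]
  ...   | zero   | 0<h | h<1    = ℕP.<-irrefl refl (ℕP.≤-<-trans 0<h h<1)
  ...   | suc k′ | 0<h | h<2^k =
    no-small-period k′ (y ^ 2) h ±𝟙-distinct
      (≈-mod-trans (≈-mod-reflexive (sym (^-*-comm y 2 (2 ℕ.^ k′)))) y^2^k≈-𝟙) 0<h h<2^k
      (≈-mod-trans (≈-mod-reflexive (sym (^-*-comm y 2 h))) y^t≈𝟙)

module LucasLehmer where
  open import Data.Nat as ℕ using (_+_; _*_; _∸_; _≤_; _<_; z≤n; s≤s; NonZero; NonTrivial)
  open import Data.Nat.Properties
    using (+-comm; ^-monoʳ-≤; ≮⇒≥; m<n⇒0<n∸m; m∸n≤m; ≤-<-trans; <-≤-trans; m+[n∸m]≡n; <⇒≤; <-irrefl;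
           *-mono-<)
  open import Data.Nat.DivMod using (_%_)
  open import Data.Nat.Divisibility
    using (_∣_; quotient; quotient-∣; quotient>1; m∣n⇒n≡quotient*m; ∣m+n∣m⇒∣n; ∣1⇒≡1; m∣m*n)
  open import Data.Nat.Primality using (Prime; prime; Composite; composite)
  import Data.Nat.Tactic.RingSolver as ℕSolver
  open import Data.Integer as ℤ using (+_; -_)
  open import Data.Integer.Properties using (pos-+; pos-*)
  import Data.Integer.Divisibility.Signed as ℤ∣
  open import Data.Integer.Tactic.RingSolver using (solve-∀)
  open import Relation.Nullary using (¬_; contradiction)
  open Congruence
  open QuadraticIntegers

  -- residue m k is sₖ mod (m + 1) for s₀ = 2, sₖ₊₁ = 2sₖ² − 1 (half the classical Lucas–Lehmer
  -- sequence 4, 14, 194, …); adding m stands for subtracting 1 without truncation.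
  residue-step : ℕ → ℕ → ℕ
  residue-step m r = (2 * r * r + m) % suc m

  residue : ℕ → ℕ → ℕ
  residue m zero    = 2
  residue m (suc k) = residue-step m (residue m k)

  ≡-residue-step : ∀ m r → T₂ (+ r) ≡ + residue-step m r mod suc m
  ≡-residue-step m r = begin
    T₂ (+ r)                       ≈⟨ +-cong-mod (≡-mod-refl (+ 2 ℤ.* + r ℤ.* + r)) -1≡m ⟩
    + 2 ℤ.* + r ℤ.* + r ℤ.+ + m    ≡⟨ cast ⟩
    + (2 * r * r + m)              ≈⟨ %-≡-mod (2 * r * r + m) (suc m) ⟩
    + residue-step m r             ∎
    where
    open ≡-mod-Reasoning (suc m)
    identity : ∀ m → - + 1 ℤ.- m ≡ - + 1 ℤ.* (+ 1 ℤ.+ m)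
    identity = solve-∀
    -1≡m : - + 1 ≡ + m mod suc m
    -1≡m = congruent (ℤ∣.divides (- + 1) (identity (+ m)))
    cast : + 2 ℤ.* + r ℤ.* + r ℤ.+ + m ≡ + (2 * r * r + m)
    cast = sym (trans (pos-+ (2 * r * r) m)
                      (cong (ℤ._+ + m) (trans (pos-* (2 * r) r) (cong (ℤ._* + r) (pos-* 2 r)))))

  re-ω^2^k : ∀ m k → re (ω ^ (2 ℕ.^ k)) ≡ + residue m k mod suc m
  re-ω^2^k m zero    = ≡-mod-refl (+ 2)
  re-ω^2^k m (suc k) = begin
    re (ω ^ (2 ℕ.^ suc k))        ≡⟨ cong re (^-double ω k) ⟩
    re (x · x)                    ≡⟨ re-square x (norm-^ ω (2 ℕ.^ k) refl) ⟩
    T₂ (re x)                     ≈⟨ T₂-cong-mod (re-ω^2^k m k) ⟩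
    T₂ (+ r)                      ≈⟨ ≡-residue-step m r ⟩
    + residue m (suc k)           ∎
    where
    open ≡-mod-Reasoning (suc m)
    x = ω ^ (2 ℕ.^ k)
    r = residue m k

  divisor-bound : ∀ p q → 3 ≤ q → re (ω ^ (2 ℕ.^ p)) ≡ + 0 mod q → 2 ℕ.^ (2 + p) ≤ q * q
  divisor-bound p q 3≤q root = ≮⇒≥ λ q²<2^[p+2] →
    let i , j , i<j , j<2^[p+2] , ω^i≈ω^j = powers-collide ω q ⦃ q≢0 ⦄ (2 ℕ.^ (2 + p)) q²<2^[p+2]
        i+[j-i]≡j = m+[n∸m]≡n (<⇒≤ i<j)
    in no-small-period (suc p) ω (j ∸ i) (𝟙≉-𝟙 3≤q) ω^2^[p+1]≈-𝟙 (m<n⇒0<n∸m i<j)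
         (≤-<-trans (m∸n≤m j i) j<2^[p+2])
         (period ω ω̄ i (j ∸ i) refl (subst (λ n → ω ^ i ≈ ω ^ n mod q) (sym i+[j-i]≡j) ω^i≈ω^j))
    where
    q≢0 : NonZero q
    q≢0 = ℕ.>-nonZero (<-≤-trans (s≤s z≤n) 3≤q)
    ω^2^[p+1]≈-𝟙 : ω ^ (2 ℕ.^ suc p) ≈ -𝟙 mod q
    ω^2^[p+1]≈-𝟙 = ≈-mod-trans (≈-mod-reflexive (^-double ω p))
                     (square-of-root (ω ^ (2 ℕ.^ p)) (norm-^ ω (2 ℕ.^ p) refl) root)

  prime-if-divisors-large : ∀ {n} .{{_ : NonTrivial n}} →
                            (∀ {d} → 1 < d → d ∣ n → n < d * d) → Prime n
  prime-if-divisors-large {n} large = prime not-composite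
    where
    identity : ∀ c d → c * c * (d * d) ≡ c * d * (c * d)
    identity = ℕSolver.solve-∀
    not-composite : ¬ Composite n
    not-composite (composite {d} d<n d∣n) =
      <-irrefl (sym (trans (identity c d) (cong (λ m → m * m) (sym (m∣n⇒n≡quotient*m d∣n)))))
        (*-mono-< (large (quotient>1 d∣n d<n) (quotient-∣ d∣n)) (large (ℕ.nonTrivial⇒n>1 d) d∣n))
      where c = quotient d∣n

  lucas-lehmer : ∀ p m → 2 + m ≡ 2 ℕ.^ (2 + p) → residue m p ≡ 0 → Prime (suc m)
  lucas-lehmer p m 2+m≡2^[p+2] sₚ≡0 = prime-if-divisors-large ⦃ ℕ.n>1⇒nonTrivial 1<1+m ⦄ large
    where
    1<1+m : 1 < suc m
    1<1+m = <⇒≤ (ℕ.s≤s⁻¹ (subst (4 ≤_) (sym 2+m≡2^[p+2]) (^-monoʳ-≤ 2 (s≤s (s≤s (z≤n {p}))))))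
    root : re (ω ^ (2 ℕ.^ p)) ≡ + 0 mod suc m
    root = subst (λ r → re (ω ^ (2 ℕ.^ p)) ≡ + r mod suc m) sₚ≡0 (re-ω^2^k m p)
    odd : ¬ 2 ∣ suc m
    odd 2∣1+m = contradiction (∣1⇒≡1 (∣m+n∣m⇒∣n 2∣[1+m]+1 2∣1+m)) λ ()
      where
      2∣[1+m]+1 : 2 ∣ suc m + 1
      2∣[1+m]+1 = subst (2 ∣_) (trans (sym 2+m≡2^[p+2]) (+-comm 1 (suc m))) (m∣m*n (2 ℕ.^ (1 + p)))
    large : ∀ {d} → 1 < d → d ∣ suc m → suc m < d * d
    large {suc zero}                (s≤s ())
    large {suc (suc zero)}          _ 2∣1+m = contradiction 2∣1+m odd
    large {d@(suc (suc (suc _)))}   _ d∣1+m =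
      subst (_≤ d * d) (sym 2+m≡2^[p+2])
        (divisor-bound p d (s≤s (s≤s (s≤s z≤n))) (≡-mod-∣ d∣1+m root))

module Binomial where
  open import Data.Nat using (_+_; _*_; _^_)
  open import Data.Integer as ℤ using (+_)
  open import Data.Integer.Properties using (pos-+)
  import Data.Nat.Tactic.RingSolver as ℕSolver
  import Data.Integer.Tactic.RingSolver as ℤSolver
  open import Data.Product using (∃)

  binomial-remainder-ℕ : ∀ d k → ∃ λ t → (1 + d) ^ k ≡ 1 + k * d + d * d * t
  binomial-remainder-ℕ d zero    = 0 , identity d
    where identity : ∀ d → 1 ≡ 1 + 0 * d + d * d * 0
          identity = ℕSolver.solve-∀
  binomial-remainder-ℕ d (suc k) =
    let t , eq = binomial-remainder-ℕ d k
    in k + t + d * t , trans (cong ((1 + d) *_) eq) (identity d k t)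
    where identity : ∀ d k t → (1 + d) * (1 + k * d + d * d * t) ≡ 1 + (1 + k) * d + d * d * (k + t + d * t)
          identity = ℕSolver.solve-∀

  binomial-remainder-ℤ : ∀ d k → ∃ λ t → (+ 1 ℤ.+ d) ℤ.^ k ≡ + 1 ℤ.+ + k ℤ.* d ℤ.+ d ℤ.* d ℤ.* t
  binomial-remainder-ℤ d zero    = + 0 , identity d
    where identity : ∀ d → + 1 ≡ + 1 ℤ.+ + 0 ℤ.* d ℤ.+ d ℤ.* d ℤ.* + 0
          identity = ℤSolver.solve-∀
  binomial-remainder-ℤ d (suc k) =
    let t , eq = binomial-remainder-ℤ d k
    in + k ℤ.+ t ℤ.+ d ℤ.* t ,
       trans (cong ((+ 1 ℤ.+ d) ℤ.*_) eq)
         (trans (identity d (+ k) t)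
           (cong (λ K → + 1 ℤ.+ K ℤ.* d ℤ.+ d ℤ.* d ℤ.* (+ k ℤ.+ t ℤ.+ d ℤ.* t)) (sym (pos-+ 1 k))))
    where identity : ∀ d k t → (+ 1 ℤ.+ d) ℤ.* (+ 1 ℤ.+ k ℤ.* d ℤ.+ d ℤ.* d ℤ.* t)
                              ≡ + 1 ℤ.+ (+ 1 ℤ.+ k) ℤ.* d ℤ.+ d ℤ.* d ℤ.* (k ℤ.+ t ℤ.+ d ℤ.* t)
          identity = ℤSolver.solve-∀

module Mersenne2203 where
  open import Data.Nat using (_+_; _*_; _∸_; _^_; _<_; z<s)
  open import Data.Nat.DivMod using (_/_)
  open import Data.Nat.Primality using (Prime)
  open import Data.Integer using (+_)
  open import Data.Integer.Divisibility.Signed using (divides)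
  open Congruence using (_≡_mod_; congruent)
  open LucasLehmer using (lucas-lehmer)

  -- Opaque, so that the type checker never tries to evaluate terms such as (1 + M)^(1 + M).
  opaque
    M : ℕ
    M = 2 ^ 2203 ∸ 1

    M-prime : Prime M
    M-prime = lucas-lehmer 2201 (2 ^ 2203 ∸ 2) refl refl

    1+M≡2^2203 : suc M ≡ 2 ^ 2203
    1+M≡2^2203 = refl

    M≡2-mod-5 : + M ≡ + 2 mod 5
    M≡2-mod-5 = congruent (divides (+ (M / 5)) refl)

    M≡5[M/5]+2 : M ≡ 5 * (M / 5) + 2
    M≡5[M/5]+2 = refl

    M/5>0 : 0 < M / 5
    M/5>0 = z<s

module Uniqueness where
  open import Data.Nat as ℕ using (_≤_; _≤?_; z≤n; s≤s; z<s; s<s)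
  import Data.Nat.Properties as ℕP
  import Data.Nat.Tactic.RingSolver as ℕSolver
  open import Data.Nat.Divisibility using () renaming (divides to divides-ℕ; _∣_ to _∣ᴺ_)
  open import Data.Nat.Primality using (Prime; prime⇒irreducible; prime⇒nonZero)
  open import Data.Integer using (ℤ; +_; -_; _+_; _-_; _*_; _^_; ∣_∣; NonZero; ≢-nonZero)
  open import Data.Integer.Properties
    using (+-comm; +-0-abelianGroup; pos-+; abs-*; +∣i∣≡i⊎+∣i∣≡-i; neg-involutive; *-cancelˡ-≡;
           ^-distribˡ-+-*; ^-identityʳ; i*j≢0)
  open import Data.Integer.Divisibility.Signed using (divides)
  open import Data.Integer.Tactic.RingSolver using (solve-∀)
  open import Algebra.Bundles using (AbelianGroup)
  open import Algebra.Properties.Group (AbelianGroup.group +-0-abelianGroup) using (∙-cancelʳ)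
  open import Data.Sum using (_⊎_; inj₁; inj₂)
  open import Data.Product using (∃)
  open import Relation.Nullary using (yes; no; contradiction)
  open Congruence
  open Binomial using (binomial-remainder-ℤ)
  open Mersenne2203

  i≡±∣i∣ : ∀ i → i ≡ + ∣ i ∣ ⊎ i ≡ - + ∣ i ∣
  i≡±∣i∣ i with +∣i∣≡i⊎+∣i∣≡-i i
  ... | inj₁ +∣i∣≡i  = inj₁ (sym +∣i∣≡i)
  ... | inj₂ +∣i∣≡-i = inj₂ (trans (sym (neg-involutive i)) (cong -_ (sym +∣i∣≡-i)))

  factors-of-prime : ∀ {p} → Prime p → ∀ d e → d * e ≡ + p →
                     d ≡ + 1 ⊎ d ≡ - + 1 ⊎ d ≡ + p ⊎ d ≡ - + p
  factors-of-prime {p} p-prime d e de≡p with prime⇒irreducible p-prime ∣d∣∣p | i≡±∣i∣ d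
    where
    ∣d∣∣p : ∣ d ∣ ∣ᴺ p
    ∣d∣∣p = divides-ℕ ∣ e ∣ (trans (sym (cong ∣_∣ de≡p))
                                   (trans (abs-* d e) (ℕP.*-comm ∣ d ∣ ∣ e ∣)))
  ... | inj₁ ∣d∣≡1 | inj₁ d≡∣d∣  = inj₁ (trans d≡∣d∣ (cong +_ ∣d∣≡1))
  ... | inj₁ ∣d∣≡1 | inj₂ d≡-∣d∣ = inj₂ (inj₁ (trans d≡-∣d∣ (cong (λ m → - + m) ∣d∣≡1)))
  ... | inj₂ ∣d∣≡p | inj₁ d≡∣d∣  = inj₂ (inj₂ (inj₁ (trans d≡∣d∣ (cong +_ ∣d∣≡p))))
  ... | inj₂ ∣d∣≡p | inj₂ d≡-∣d∣ = inj₂ (inj₂ (inj₂ (trans d≡-∣d∣ (cong (λ m → - + m) ∣d∣≡p))))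

  factor-≡2-mod-5 : ∀ {p} → Prime p → + p ≡ + 2 mod 5 →
                    ∀ d e → d * e ≡ + p → d ≡ + 2 mod 5 → d ≡ + p
  factor-≡2-mod-5 p-prime p≡2 d e de≡p d≡2 with factors-of-prime p-prime d e de≡p
  ... | inj₁ refl                = contradiction d≡2 (≢-mod z<s (s<s z<s))
  ... | inj₂ (inj₁ refl)         = contradiction d≡2 (≢-mod z<s (s<s (s<s (s<s z<s))))
  ... | inj₂ (inj₂ (inj₁ d≡p))   = d≡p
  ... | inj₂ (inj₂ (inj₂ refl))  =
    contradiction (≡-mod-trans (≡-mod-sym d≡2) (-‿cong-mod p≡2)) (≢-mod z<s ℕP.≤-refl)

  linear-chain : ∀ {x₂ x₃ x₄ x₅ x₆ x₇ x₈} → x₂ + x₂ ≡ x₃ → x₃ + x₃ ≡ x₄ → x₄ + x₂ ≡ x₅ → x₆ ≡ + 1 →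
                 x₅ + x₆ ≡ x₇ → x₇ + x₆ ≡ x₈ → x₈ ≡ + 5 * x₂ + + 2
  linear-chain {x₂} refl refl refl refl refl refl = identity x₂
    where identity : ∀ x → x + x + (x + x) + x + + 1 + + 1 ≡ + 5 * x + + 2
          identity = solve-∀

  binomial-cancel : ∀ d y t M → d * d * y + (+ 1 + d) ≡ + 1 + (+ 1 + M) * d + d * d * t →
                    d * (d * (y - t)) ≡ d * M
  binomial-cancel d y t M eq = begin
    d * (d * (y - t))                   ≡⟨ identity d y t M ⟩
    (d * d * y + (+ 1 + d)) - w + d * M ≡⟨ cong (λ z → z - w + d * M) eq ⟩
    w - w + d * M                       ≡⟨ cancel w (d * M) ⟩
    d * M                               ∎
    where
    open ≡-Reasoning
    w = + 1 + (+ 1 + M) * d + d * d * t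
    identity : ∀ d y t M →
      d * (d * (y - t)) ≡ (d * d * y + (+ 1 + d)) - (+ 1 + (+ 1 + M) * d + d * d * t) + d * M
    identity = solve-∀
    cancel : ∀ w v → w - w + v ≡ v
    cancel = solve-∀

  module _ {n x} (S : Solves n x) where
    open Solves S

    x[n+8]≡5x[n+2]+2 : x (n ℕ.+ 8) ≡ + 5 * x (n ℕ.+ 2) + + 2
    x[n+8]≡5x[n+2]+2 = linear-chain e2 e3 e4 e6 e7 e8

    x[n+8]≡2-mod-5 : x (n ℕ.+ 8) ≡ + 2 mod 5
    x[n+8]≡2-mod-5 = congruent (divides (x (n ℕ.+ 2))
      (trans (cong (_- + 2) x[n+8]≡5x[n+2]+2) (identity (x (n ℕ.+ 2)))))
      where identity : ∀ z → + 5 * z + + 2 - + 2 ≡ z * + 5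
            identity = solve-∀

    x[1]≡1+x[n+8] : x 1 ≡ + 1 + x (n ℕ.+ 8)
    x[1]≡1+x[n+8] = trans (sym e1) (trans (cong (λ y → x (n ℕ.+ 8) + y) e6) (+-comm (x (n ℕ.+ 8)) (+ 1)))

    x[1+j]≡x[1]^2^j : ∀ j → j ≤ n → x (suc j) ≡ x 1 ^ (2 ℕ.^ j)
    x[1+j]≡x[1]^2^j zero    _     = sym (^-identityʳ (x 1))
    x[1+j]≡x[1]^2^j (suc j) 1+j≤n = begin
      x (suc (suc j))                     ≡⟨ cong x (ℕP.+-comm 1 (suc j)) ⟩
      x (suc j ℕ.+ 1)                     ≡⟨ sym (sq (suc j) (s≤s z≤n) 1+j≤n) ⟩
      x (suc j) * x (suc j)               ≡⟨ cong₂ _*_ ih ih ⟩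
      x 1 ^ (2 ℕ.^ j) * x 1 ^ (2 ℕ.^ j)   ≡⟨ sym (^-distribˡ-+-* (x 1) (2 ℕ.^ j) (2 ℕ.^ j)) ⟩
      x 1 ^ (2 ℕ.^ j ℕ.+ 2 ℕ.^ j)
        ≡⟨ cong (λ m → x 1 ^ (2 ℕ.^ j ℕ.+ m)) (sym (ℕP.+-identityʳ (2 ℕ.^ j))) ⟩
      x 1 ^ (2 ℕ.^ suc j)                 ∎
      where
      open ≡-Reasoning
      ih = x[1+j]≡x[1]^2^j j (ℕP.<⇒≤ 1+j≤n)

    x[n+8]≡M : 2203 ≤ n → x (n ℕ.+ 8) ≡ + M
    x[n+8]≡M n≥2203 = factor-≡2-mod-5 M-prime M≡2-mod-5 d (y - t) d[y-t]≡M x[n+8]≡2-mod-5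
      where
      open ≡-Reasoning
      d = x (n ℕ.+ 8)
      y = x (n ℕ.+ 10)
      t = proj₁ (binomial-remainder-ℤ d (suc M))
      -- The exponent 2^2203 is rewritten to 1 + M by subst: checking this step by cong instead
      -- makes the type checker unfold x₁^(2^2203).
      expansion : d * d * y + (+ 1 + d) ≡ + 1 + (+ 1 + + M) * d + d * d * t
      expansion = begin
        d * d * y + (+ 1 + d)               ≡⟨ cong₂ _+_ (trans (cong (_* y) e9) e11) (sym x[1]≡1+x[n+8]) ⟩
        x (n ℕ.+ 11) + x 1                  ≡⟨ e2204 ⟩
        x 2204
          ≡⟨ subst (λ e → x 2204 ≡ x 1 ^ e) (sym 1+M≡2^2203) (x[1+j]≡x[1]^2^j 2203 n≥2203) ⟩
        x 1 ^ suc M                         ≡⟨ cong (_^ suc M) x[1]≡1+x[n+8] ⟩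
        (+ 1 + d) ^ suc M                   ≡⟨ proj₂ (binomial-remainder-ℤ d (suc M)) ⟩
        + 1 + + suc M * d + d * d * t       ≡⟨ cong (λ K → + 1 + K * d + d * d * t) (pos-+ 1 M) ⟩
        + 1 + (+ 1 + + M) * d + d * d * t   ∎
      d≢0 : d ≢ + 0
      d≢0 d≡0 = ≢-mod z<s (s<s (s<s z<s)) (subst (_≡ + 2 mod 5) d≡0 x[n+8]≡2-mod-5)
      d[y-t]≡M : d * (y - t) ≡ + M
      d[y-t]≡M = *-cancelˡ-≡ d _ _ ⦃ ≢-nonZero d≢0 ⦄ (binomial-cancel d y t (+ M) expansion)

  by-sum : ∀ {u v w u′ v′ w′ : ℤ} → u ≡ u′ → v ≡ v′ → u + v ≡ w → u′ + v′ ≡ w′ → w ≡ w′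
  by-sum refl refl refl refl = refl

  by-product : ∀ {u v w u′ v′ w′ : ℤ} → u ≡ u′ → v ≡ v′ → u * v ≡ w → u′ * v′ ≡ w′ → w ≡ w′
  by-product refl refl refl refl = refl

  index-split : ∀ {n i} → InRange n i →
                (∃ λ j → j ≤ n × i ≡ suc j) ⊎ (∃ λ j → j ≤ 9 × i ≡ n ℕ.+ (2 ℕ.+ j))
  index-split {n} {suc j} (_ , 1+j≤n+11) with j ≤? n
  ... | yes j≤n = inj₁ (j , j≤n , refl)
  ... | no  j≰n = inj₂ (k , k≤9 , sym (trans (shift n k) 2+n+k≡1+j))
    where
    k = suc j ℕ.∸ (2 ℕ.+ n)
    2+n+k≡1+j : 2 ℕ.+ n ℕ.+ k ≡ suc j
    2+n+k≡1+j = ℕP.m+[n∸m]≡n (s≤s (ℕP.≰⇒> j≰n))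
    shift : ∀ n k → n ℕ.+ (2 ℕ.+ k) ≡ 2 ℕ.+ n ℕ.+ k
    shift = ℕSolver.solve-∀
    k≤9 : k ≤ 9
    k≤9 = ℕP.+-cancelˡ-≤ (2 ℕ.+ n) k 9 (subst₂ _≤_ (sym 2+n+k≡1+j) (shift n 9) 1+j≤n+11)

  module Agreement {n a b} (n≥2203 : 2203 ≤ n) (Sa : Solves n a) (Sb : Solves n b) where
    private
      module A = Solves Sa
      module B = Solves Sb

    at-n+2 : a (n ℕ.+ 2) ≡ b (n ℕ.+ 2)
    at-n+2 = *-cancelˡ-≡ (+ 5) _ _ (∙-cancelʳ (+ 2) _ _ (begin
      + 5 * a (n ℕ.+ 2) + + 2  ≡⟨ sym (x[n+8]≡5x[n+2]+2 Sa) ⟩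
      a (n ℕ.+ 8)              ≡⟨ x[n+8]≡M Sa n≥2203 ⟩
      + M                      ≡⟨ sym (x[n+8]≡M Sb n≥2203) ⟩
      b (n ℕ.+ 8)              ≡⟨ x[n+8]≡5x[n+2]+2 Sb ⟩
      + 5 * b (n ℕ.+ 2) + + 2  ∎))
      where open ≡-Reasoning

    at-n+3 : a (n ℕ.+ 3) ≡ b (n ℕ.+ 3)
    at-n+3 = by-sum at-n+2 at-n+2 A.e2 B.e2
    at-n+4 : a (n ℕ.+ 4) ≡ b (n ℕ.+ 4)
    at-n+4 = by-sum at-n+3 at-n+3 A.e3 B.e3
    at-n+5 : a (n ℕ.+ 5) ≡ b (n ℕ.+ 5)
    at-n+5 = by-sum at-n+4 at-n+2 A.e4 B.e4
    at-n+6 : a (n ℕ.+ 6) ≡ b (n ℕ.+ 6)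
    at-n+6 = trans A.e6 (sym B.e6)
    at-n+7 : a (n ℕ.+ 7) ≡ b (n ℕ.+ 7)
    at-n+7 = by-sum at-n+5 at-n+6 A.e7 B.e7
    at-n+8 : a (n ℕ.+ 8) ≡ b (n ℕ.+ 8)
    at-n+8 = by-sum at-n+7 at-n+6 A.e8 B.e8
    at-n+9 : a (n ℕ.+ 9) ≡ b (n ℕ.+ 9)
    at-n+9 = by-product at-n+8 at-n+8 A.e9 B.e9
    at-1 : a 1 ≡ b 1
    at-1 = by-sum at-n+8 at-n+6 A.e1 B.e1

    at-1+j : ∀ j → j ≤ n → a (suc j) ≡ b (suc j)
    at-1+j j j≤n =
      trans (x[1+j]≡x[1]^2^j Sa j j≤n) (trans (cong (_^ (2 ℕ.^ j)) at-1) (sym (x[1+j]≡x[1]^2^j Sb j j≤n)))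

    at-n+11 : a (n ℕ.+ 11) ≡ b (n ℕ.+ 11)
    at-n+11 = ∙-cancelʳ (b 1) _ _
      (trans (cong (λ y → a (n ℕ.+ 11) + y) (sym at-1))
             (trans A.e2204 (trans (at-1+j 2203 n≥2203) (sym B.e2204))))

    at-n+10 : a (n ℕ.+ 10) ≡ b (n ℕ.+ 10)
    at-n+10 = *-cancelˡ-≡ (a (n ℕ.+ 9)) _ _ ⦃ a[n+9]≢0 ⦄
      (trans A.e11 (trans at-n+11 (trans (sym B.e11) (cong (_* b (n ℕ.+ 10)) (sym at-n+9)))))
      where
      a[n+9]≡M² : a (n ℕ.+ 9) ≡ + M * + M
      a[n+9]≡M² = trans (sym A.e9) (cong₂ _*_ (x[n+8]≡M Sa n≥2203) (x[n+8]≡M Sa n≥2203))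
      a[n+9]≢0 : NonZero (a (n ℕ.+ 9))
      a[n+9]≢0 = subst NonZero (sym a[n+9]≡M²)
                   (i*j≢0 (+ M) (+ M) ⦃ prime⇒nonZero M-prime ⦄ ⦃ prime⇒nonZero M-prime ⦄)

    at-n+2+j : ∀ j → j ≤ 9 → a (n ℕ.+ (2 ℕ.+ j)) ≡ b (n ℕ.+ (2 ℕ.+ j))
    at-n+2+j 0 _ = at-n+2
    at-n+2+j 1 _ = at-n+3
    at-n+2+j 2 _ = at-n+4
    at-n+2+j 3 _ = at-n+5
    at-n+2+j 4 _ = at-n+6
    at-n+2+j 5 _ = at-n+7
    at-n+2+j 6 _ = at-n+8
    at-n+2+j 7 _ = at-n+9
    at-n+2+j 8 _ = at-n+10
    at-n+2+j 9 _ = at-n+11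
    at-n+2+j (suc (suc (suc (suc (suc (suc (suc (suc (suc (suc _))))))))))
             (s≤s (s≤s (s≤s (s≤s (s≤s (s≤s (s≤s (s≤s (s≤s ())))))))))

    agree : ∀ i → InRange n i → a i ≡ b i
    agree i i∈ with index-split i∈
    ... | inj₁ (j , j≤n , refl) = at-1+j j j≤n
    ... | inj₂ (j , j≤9 , refl) = at-n+2+j j j≤9

module Existence where
  open import Data.Nat using (_+_; _*_; _∸_; _^_; _≤_; _<_; _≤?_; z≤n; s≤s; z<s)
  open import Data.Nat.Properties
    using (+-assoc; +-comm; +-suc; +-identityʳ; *-comm; *-identityʳ; m+n∸m≡n; ^-distribˡ-+-*; ^-*-assoc;
           m≤m+n; m<m+n; m<n+m; ≤-refl; <-≤-trans; ≤-<-trans; <-irrefl; <⇒≤; *-mono-<; *-monoʳ-<; ^-monoʳ-<;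
           m^n>0; m^n≢0)
  open import Data.Nat.DivMod using (_/_)
  open import Data.Integer as ℤ using (+_)
  open import Data.Integer.Properties using (pos-+; pos-*)
  import Data.Nat.Tactic.RingSolver as ℕSolver
  open import Data.Empty using (⊥-elim)
  open import Relation.Nullary using (yes; no)
  open Binomial using (binomial-remainder-ℕ)
  open Mersenne2203

  N k Q : ℕ
  N = suc M
  k = M / 5
  Q = suc (proj₁ (binomial-remainder-ℕ M N))

  M²Q+N≡N^N : M * M * Q + N ≡ N ^ N
  M²Q+N≡N^N = begin
    M * M * suc t + N          ≡⟨ identity M t ⟩
    1 + N * M + M * M * t      ≡⟨ sym (proj₂ (binomial-remainder-ℕ M N)) ⟩
    N ^ N                      ∎
    where
    open ≡-Reasoning
    t = proj₁ (binomial-remainder-ℕ M N)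
    identity : ∀ M t → M * M * suc t + suc M ≡ 1 + suc M * M + M * M * t
    identity = ℕSolver.solve-∀

  -- tail j is the value of x_{n+2+j}; the last clause is junk, outside the range 0 … 9.
  tail : ℕ → ℕ
  tail 0 = k
  tail 1 = tail 0 + tail 0
  tail 2 = tail 1 + tail 1
  tail 3 = tail 2 + tail 0
  tail 4 = 1
  tail 5 = tail 3 + tail 4
  tail 6 = tail 5 + tail 4
  tail 7 = tail 6 * tail 6
  tail 8 = Q
  tail 9 = tail 7 * tail 8
  tail _ = 1

  tail-6≡M : tail 6 ≡ M
  tail-6≡M = trans (identity k) (sym M≡5[M/5]+2)
    where identity : ∀ k → k + k + (k + k) + k + 1 + 1 ≡ 5 * k + 2
          identity = ℕSolver.solve-∀

  tail-positive : ∀ j → 0 < tail j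
  tail-positive 0 = M/5>0
  tail-positive 1 = <-≤-trans (tail-positive 0) (m≤m+n (tail 0) (tail 0))
  tail-positive 2 = <-≤-trans (tail-positive 1) (m≤m+n (tail 1) (tail 1))
  tail-positive 3 = <-≤-trans (tail-positive 2) (m≤m+n (tail 2) (tail 0))
  tail-positive 4 = z<s
  tail-positive 5 = <-≤-trans (tail-positive 3) (m≤m+n (tail 3) 1)
  tail-positive 6 = <-≤-trans (tail-positive 5) (m≤m+n (tail 5) 1)
  tail-positive 7 = *-mono-< (tail-positive 6) (tail-positive 6)
  tail-positive 8 = z<s
  tail-positive 9 = *-mono-< (tail-positive 7) (tail-positive 8)
  tail-positive (suc (suc (suc (suc (suc (suc (suc (suc (suc (suc _)))))))))) = z<s

  solution : ℕ → ℕ → ℕ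
  solution n i with i ≤? suc n
  ... | yes _ = N ^ (2 ^ (i ∸ 1))
  ... | no  _ = tail (i ∸ (n + 2))

  solution-low : ∀ n j → j ≤ n → solution n (suc j) ≡ N ^ (2 ^ j)
  solution-low n j j≤n with suc j ≤? suc n
  ... | yes _       = refl
  ... | no  1+j≰1+n = ⊥-elim (1+j≰1+n (s≤s j≤n))

  solution-high : ∀ n j → solution n (n + (2 + j)) ≡ tail j
  solution-high n j with n + (2 + j) ≤? suc n
  ... | yes n+2+j≤1+n = ⊥-elim (<-irrefl refl (≤-<-trans n+2+j≤1+n 1+n<n+2+j))
    where 1+n<n+2+j : suc n < n + (2 + j)
          1+n<n+2+j = subst (suc n <_) (sym (+-suc n (suc j))) (s≤s (m<m+n n z<s))
  ... | no  _ = cong tail (trans (cong (_∸ (n + 2)) (sym (+-assoc n 2 j))) (m+n∸m≡n (n + 2) j))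

  solution-positive : ∀ n i → 0 < solution n i
  solution-positive n i with i ≤? suc n
  ... | yes _ = m^n>0 N (2 ^ (i ∸ 1))
  ... | no  _ = tail-positive (i ∸ (n + 2))

  solution-large : ∀ n → 2 ^ (2 ^ (n + 11)) < solution n (suc n)
  solution-large n = subst (2 ^ (2 ^ (n + 11)) <_) (sym value) (^-monoʳ-< 2 (s≤s (s≤s z≤n)) exponent)
    where
    value : solution n (suc n) ≡ 2 ^ (2203 * 2 ^ n)
    value = trans (solution-low n n ≤-refl) (trans (cong (_^ (2 ^ n)) 1+M≡2^2203) (^-*-assoc 2 2203 (2 ^ n)))
    exponent : 2 ^ (n + 11) < 2203 * 2 ^ n
    exponent = subst₂ _<_ (sym (^-distribˡ-+-* 2 n 11)) (*-comm (2 ^ n) 2203)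
                 (*-monoʳ-< (2 ^ n) ⦃ m^n≢0 2 n ⦄ (m<n+m 2048 {155} z<s))

  ^-2^-suc : ∀ m j → m ^ (2 ^ suc j) ≡ m ^ (2 ^ j) * m ^ (2 ^ j)
  ^-2^-suc m j = trans (cong (λ e → m ^ (2 ^ j + e)) (+-identityʳ (2 ^ j))) (^-distribˡ-+-* m (2 ^ j) (2 ^ j))

  sum-of-pos : ∀ {x y z u v} → x ≡ + u → y ≡ + v → z ≡ + (u + v) → x ℤ.+ y ≡ z
  sum-of-pos {u = u} {v} refl refl refl = sym (pos-+ u v)

  product-of-pos : ∀ {x y z u v} → x ≡ + u → y ≡ + v → z ≡ + (u * v) → x ℤ.* y ≡ z
  product-of-pos {u = u} {v} refl refl refl = sym (pos-* u v)

  solution-solves : ∀ {n} → 2203 ≤ n → Solves n (λ i → + solution n i)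
  solution-solves {n} n≥2203 = record
    { sq    = λ { (suc j) _ 1+j≤n → product-of-pos (low j (<⇒≤ 1+j≤n)) (low j (<⇒≤ 1+j≤n)) (square j 1+j≤n) }
    ; e2    = sum-of-pos (high 0) (high 0) (high 1)
    ; e3    = sum-of-pos (high 1) (high 1) (high 2)
    ; e4    = sum-of-pos (high 2) (high 0) (high 3)
    ; e6    = high 4
    ; e7    = sum-of-pos (high 3) (high 4) (high 5)
    ; e8    = sum-of-pos (high 5) (high 4) (high 6)
    ; e1    = sum-of-pos (high 6) (high 4) (cong +_ (trans x₁≡N (sym tail-6+1≡N)))
    ; e9    = product-of-pos (high 6) (high 6) (high 7)
    ; e11   = product-of-pos (high 7) (high 8) (high 9)
    ; e2204 = sum-of-pos (high 9) (cong +_ x₁≡N) (cong +_ x₂₂₀₄≡tail-9+N)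
    }
    where
    open ≡-Reasoning
    high : ∀ j → + solution n (n + (2 + j)) ≡ + tail j
    high j = cong +_ (solution-high n j)
    low : ∀ j → j ≤ n → + solution n (suc j) ≡ + (N ^ (2 ^ j))
    low j j≤n = cong +_ (solution-low n j j≤n)
    square : ∀ j → suc j ≤ n → + solution n (suc j + 1) ≡ + (N ^ (2 ^ j) * N ^ (2 ^ j))
    square j 1+j≤n = cong +_ (trans (cong (solution n) (+-comm (suc j) 1))
                                    (trans (solution-low n (suc j) 1+j≤n) (^-2^-suc N j)))
    x₁≡N : solution n 1 ≡ N
    x₁≡N = trans (solution-low n 0 z≤n) (*-identityʳ N)
    tail-6+1≡N : tail 6 + 1 ≡ N
    tail-6+1≡N = trans (cong (_+ 1) tail-6≡M) (+-comm M 1)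
    x₂₂₀₄≡tail-9+N : solution n 2204 ≡ tail 9 + N
    x₂₂₀₄≡tail-9+N = begin
      solution n 2204   ≡⟨ subst (λ e → solution n 2204 ≡ N ^ e) (sym 1+M≡2^2203)
                                 (solution-low n 2203 n≥2203) ⟩
      N ^ N             ≡⟨ sym M²Q+N≡N^N ⟩
      M * M * Q + N     ≡⟨ cong (λ m → m * m * Q + N) (sym tail-6≡M) ⟩
      tail 9 + N        ∎

open import Data.Nat using (_≤_; _^_; z≤n; s≤s)
open import Data.Nat.Properties using (m≤n+m; +-comm)
open import Data.Integer using (+_; _<_; +<+)
open import Data.Product using (∃-syntax)
open Existence using (solution; solution-solves; solution-positive; solution-large)
open Uniqueness using (module Agreement)

theorem1 : (n : ℕ) → 2203 ≤ n →
    ∃[ a ] (Solves n a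
    × (∀ b → Solves n b → ∀ i → InRange n i → b i ≡ a i)
    × (∀ i → InRange n i → + 0 < a i)
    × ∃[ i ] (InRange n i × + (2 ^ (2 ^ (n Data.Nat.+ 11))) < a i))
theorem1 n n≥2203 =
  (λ i → + solution n i) , solves ,
  (λ b b-solves → Agreement.agree n≥2203 b-solves solves) ,
  (λ i _ → +<+ (solution-positive n i)) ,
  suc n , (s≤s z≤n , subst (suc n ≤_) (+-comm 11 n) (s≤s (m≤n+m n 10))) , +<+ (solution-large n)
  where
  solves : Solves n (λ i → + solution n i)
  solves = solution-solves n≥2203
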